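{- Let $a,b,c_1,c_2,c_3,c_4$ be positive integers, $\sigma$ a permutation of $\{1,2,3,4\}$, and $F(\mathbf x)=a(c_1x_{\sigma(1)})^4+b(c_2x_{\sigma(2)})^4+4a(c_3x_{\sigma(3)})^4+4b(c_4x_{\sigma(4)})^4$. Let $q$ be a prime with $q\equiv1\pmod4$ and $q\nmid abc_1c_2c_3c_4$. Then $r_F(0,q)\geq q^3$.
   Context: $r_F(0,q)$ is the number of $\mathbf x\in(\mathbb Z/q\mathbb Z)^4$ with $F(\mathbf x)\equiv0\pmod q$. -}

module Defs where

open import Data.Nat using (ℕ; zero; suc; _+_; _*_; _^_; _%_; NonZero)
open import Data.Nat.Properties using (_≟_)
open import Data.Fin using (Fin; toℕ; zero; suc)
open import Data.Fin.Permutation using (Permutation′; _⟨$⟩ʳ_)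
open import Data.List using (List; length; filter; allFin; cartesianProductWith) renaming (_∷_ to _∷ᴸ_; [] to L[])
open import Data.Vec using (Vec; _∷_; []; lookup)
open import Relation.Nullary.Decidable using (Dec)
open import Relation.Binary.PropositionalEquality using (_≡_)

Point : ℕ → Set
Point q = Vec (Fin q) 4

allVecs : (q n : ℕ) → List (Vec (Fin q) n)
allVecs q zero = [] ∷ᴸ L[]
allVecs q (suc n) = cartesianProductWith _∷_ (allFin q) (allVecs q n)

allPoints : (q : ℕ) → List (Point q)
allPoints q = allVecs q 4

-- the form F(x) = a(c₁x_{σ(1)})⁴ + b(c₂x_{σ(2)})⁴ + 4a(c₃x_{σ(3)})⁴ + 4b(c₄x_{σ(4)})⁴
-- evaluated on integer representatives (Fin 4 indices 0..3 stand for 1..4)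
F : (a b c₁ c₂ c₃ c₄ : ℕ) → Permutation′ 4 → (x : Fin 4 → ℕ) → ℕ
F a b c₁ c₂ c₃ c₄ σ x =
    a * (c₁ * x (σ ⟨$⟩ʳ zero)) ^ 4
  + b * (c₂ * x (σ ⟨$⟩ʳ suc zero)) ^ 4
  + 4 * a * (c₃ * x (σ ⟨$⟩ʳ suc (suc zero))) ^ 4
  + 4 * b * (c₄ * x (σ ⟨$⟩ʳ suc (suc (suc zero)))) ^ 4

rF0 : (a b c₁ c₂ c₃ c₄ : ℕ) → Permutation′ 4 → (q : ℕ) → .{{NonZero q}} → ℕ
rF0 a b c₁ c₂ c₃ c₄ σ q =
  length (filter (λ x → F a b c₁ c₂ c₃ c₄ σ (λ i → toℕ (lookup x i)) % q ≟ 0) (allPoints q))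

-- Since q ≡ 1 (mod 4), −1 is a square modulo q: pairing each x ∈ {2, …, (q − 1)/2} with the
-- representative of ±x⁻¹ is an involution of a set of odd size, and a fixed point is a square
-- root of −1.  For such a root i, t = 1 + i satisfies t⁴ ≡ −4, so with Q(u, v) = a u⁴ + b v⁴
--   F(x) ≡ Q(c₁x_{σ(1)}, c₂x_{σ(2)}) − Q(t c₃x_{σ(3)}, t c₄x_{σ(4)})   (mod q),
-- and the substitution inside Q is an invertible change of variables of (ℤ/qℤ)⁴.  Hence r_F(0, q)
-- counts the pairs of points of (ℤ/qℤ)² on which Q agrees modulo q, and by Cauchy–Schwarz over
-- the q fibres of Q this number is at least (q²)²/q = q³.

module Submission where

open import Defs
open import Data.Nat using (ℕ; _*_; _^_; _%_; _≤_; _>_)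
open import Data.Nat.Primality using (Prime; prime⇒nonZero)
open import Data.Nat.Divisibility using (_∣_)
open import Data.Fin.Permutation using (Permutation′)
open import Relation.Nullary using (¬_)
open import Relation.Binary.PropositionalEquality using (_≡_)

open import Level using (0ℓ)
open import Data.Nat using (zero; suc; _+_; _∸_; _<_; pred; z≤n; s≤s; NonZero; >-nonZero⁻¹; ≢-nonZero)
open import Data.Nat.Properties
open import Data.Nat.DivMod
open import Data.Nat.Divisibility
  using (m%n≡0⇒n∣m; n∣m⇒m%n≡0; ∣-refl; n∣m*n; ∣1⇒≡1; ∣m⇒∣m*n; ∣n⇒∣m*n; ∣m+n∣m⇒∣n; ∣⇒≤)
open import Data.Nat.Primality using (euclidsLemma; ¬prime[1])
open import Data.Nat.Coprimality using (prime⇒coprime; coprime-Bézout)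
import Data.Nat.GCD as GCD
open import Data.Nat.ListAction using () renaming (sum to sumᴸ)
open import Data.Nat.ListAction.Properties using () renaming (sum-++ to sumᴸ-++)
open import Data.Nat.Tactic.RingSolver using (solve)
open import Data.Nat.Solver using (module +-*-Solver)
open import Data.Fin as Fin using (Fin; zero; suc; toℕ; fromℕ<; _↑ˡ_; _↑ʳ_; combine; remQuot)
import Data.Fin.Properties as Fin
open import Data.Fin.Permutation using (permutation; _⟨$⟩ʳ_; _⟨$⟩ˡ_; inverseˡ; inverseʳ)
open import Data.Vec using (Vec; tabulate; lookup)
open import Data.Vec.Properties using (lookup∘tabulate; tabulate∘lookup; tabulate-cong)
open import Data.List using (_∷_; [])
import Data.List as List
import Data.List.Properties as List
open import Data.Product using (∃; _×_; _,_; proj₁; proj₂)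
open import Data.Sum as Sum using (_⊎_; inj₁; inj₂)
open import Data.Empty using (⊥-elim)
open import Algebra.Properties.Semiring.Sum +-*-semiring
  using (sum; sum-syntax; sum-cong-≗; sum-permute; ∑-distrib-+; ∑-comm; sum-replicate-zero; *-distribˡ-sum; *-distribʳ-sum)
open import Function using (_∘_; id)
open import Function.Bundles using (_↔_; Inverse; mk↔ₛ′; _⇔_; Equivalence; mk⇔)
open import Function.Properties.Equivalence using (⇔-setoid)
open import Relation.Nullary using (Dec; yes; no; contradiction)
open import Relation.Unary using (Pred; Decidable)
open import Relation.Binary.Bundles using (Setoid)
open import Relation.Binary.Structures using (IsEquivalence)
open import Relation.Binary.Definitions using (tri<; tri≈; tri>)
open import Relation.Binary.PropositionalEquality
  using (_≢_; refl; sym; trans; cong; cong₂; subst; subst₂; module ≡-Reasoning)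
import Relation.Binary.Reasoning.Setoid as SetoidReasoning

-- Finite sums

indicator : ∀ {p} {P : Set p} → Dec P → ℕ
indicator (yes _) = 1
indicator (no _)  = 0

indicator-cong : ∀ {p q} {P : Set p} {Q : Set q} (P? : Dec P) (Q? : Dec Q) → P ⇔ Q → indicator P? ≡ indicator Q?
indicator-cong (yes _) (yes _) _   = refl
indicator-cong (yes p) (no ¬q) P⇔Q = contradiction (Equivalence.to P⇔Q p) ¬q
indicator-cong (no ¬p) (yes q) P⇔Q = contradiction (Equivalence.from P⇔Q q) ¬p
indicator-cong (no _)  (no _)  _   = refl

sum-const : ∀ n c → ∑[ i < n ] c ≡ n * c
sum-const zero    c = refl
sum-const (suc n) c = cong (c +_) (sum-const n c)

sum-mono-≤ : ∀ {n} {f g : Fin n → ℕ} → (∀ i → f i ≤ g i) → sum f ≤ sum g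
sum-mono-≤ {zero}  f≤g = z≤n
sum-mono-≤ {suc n} f≤g = +-mono-≤ (f≤g zero) (sum-mono-≤ (f≤g ∘ suc))

∑-*-indicator-≟ : ∀ {n} (g : Fin n → ℕ) (i : Fin n) → ∑[ v < n ] (g v * indicator (i Fin.≟ v)) ≡ g i
∑-*-indicator-≟ {suc n} g zero = begin
  g zero * 1 + ∑[ v < n ] (g (suc v) * 0)  ≡⟨ cong₂ _+_ (*-identityʳ (g zero)) (sum-cong-≗ (*-zeroʳ ∘ g ∘ suc)) ⟩
  g zero + ∑[ v < n ] 0                   ≡⟨ cong (g zero +_) (sum-replicate-zero n) ⟩
  g zero + 0                              ≡⟨ +-identityʳ (g zero) ⟩
  g zero                                  ∎
  where open ≡-Reasoning
∑-*-indicator-≟ {suc n} g (suc i) = begin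
  g zero * 0 + ∑[ v < n ] (g (suc v) * indicator (suc i Fin.≟ suc v))
    ≡⟨ cong₂ _+_ (*-zeroʳ (g zero)) (sum-cong-≗ (λ v → cong (g (suc v) *_) (indicator-cong _ _ (mk⇔ Fin.suc-injective (cong suc))))) ⟩
  ∑[ v < n ] (g (suc v) * indicator (i Fin.≟ v))
    ≡⟨ ∑-*-indicator-≟ (g ∘ suc) i ⟩
  g (suc i) ∎
  where open ≡-Reasoning

∑-↑ : ∀ m {n} (f : Fin (m + n) → ℕ) → sum f ≡ ∑[ i < m ] f (i ↑ˡ n) + ∑[ j < n ] f (m ↑ʳ j)
∑-↑ zero    f = refl
∑-↑ (suc m) f = trans (cong (f zero +_) (∑-↑ m (f ∘ suc))) (sym (+-assoc (f zero) _ _))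

∑-combine : ∀ m {n} (f : Fin (m * n) → ℕ) → sum f ≡ ∑[ i < m ] ∑[ j < n ] f (combine i j)
∑-combine zero        f = refl
∑-combine (suc m) {n} f = trans (∑-↑ n f) (cong (∑[ j < n ] f (j ↑ˡ m * n) +_) (∑-combine m (f ∘ (n ↑ʳ_))))

-- Collisions and the Cauchy–Schwarz inequality

2ab≤a²+b² : ∀ a b → 2 * (a * b) ≤ a * a + b * b
2ab≤a²+b² a b = Sum.[ ascending , descending ]′ (≤-total a b)
  where
  ascending : ∀ {a b} → a ≤ b → 2 * (a * b) ≤ a * a + b * b
  ascending {a} a≤b with m≤n⇒∃[o]m+o≡n a≤b
  ... | d , refl = begin
    2 * (a * (a + d))                   ≤⟨ m≤m+n _ (d * d) ⟩
    2 * (a * (a + d)) + d * d           ≡⟨ solve (a ∷ d ∷ []) ⟩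
    a * a + (a + d) * (a + d)           ∎
    where open ≤-Reasoning
  descending : b ≤ a → 2 * (a * b) ≤ a * a + b * b
  descending b≤a = subst₂ _≤_ (cong (2 *_) (*-comm b a)) (+-comm (b * b) (a * a)) (ascending b≤a)

cauchy-schwarz : ∀ n (f : Fin n → ℕ) → sum f * sum f ≤ n * ∑[ v < n ] (f v * f v)
cauchy-schwarz n f = *-cancelˡ-≤ 2 (begin
  2 * (sum f * sum f)                            ≡⟨ cong (2 *_) sum²≡∑∑ ⟩
  2 * ∑[ v < n ] ∑[ w < n ] (f v * f w)          ≡⟨ *-distribˡ-∑∑ 2 (λ v w → f v * f w) ⟩
  ∑[ v < n ] ∑[ w < n ] (2 * (f v * f w))        ≤⟨ sum-mono-≤ (λ v → sum-mono-≤ (λ w → 2ab≤a²+b² (f v) (f w))) ⟩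
  ∑[ v < n ] ∑[ w < n ] (f v * f v + f w * f w)  ≡⟨ sum-cong-≗ (λ v → ∑-distrib-+ (λ _ → f v * f v) (λ w → f w * f w)) ⟩
  ∑[ v < n ] (∑[ w < n ] (f v * f v) + S)        ≡⟨ ∑-distrib-+ (λ v → ∑[ w < n ] (f v * f v)) (λ _ → S) ⟩
  ∑[ v < n ] ∑[ w < n ] (f v * f v) + ∑[ v < n ] S ≡⟨ cong₂ _+_ (sum-cong-≗ (λ v → sum-const n (f v * f v))) (sum-const n S) ⟩
  ∑[ v < n ] (n * (f v * f v)) + n * S           ≡⟨ cong (_+ n * S) (*-distribˡ-sum n (λ v → f v * f v)) ⟨
  n * S + n * S                                  ≡⟨ cong (n * S +_) (+-identityʳ (n * S)) ⟨
  2 * (n * S)                                    ∎)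
  where
  open ≤-Reasoning
  S = ∑[ v < n ] (f v * f v)
  sum²≡∑∑ : sum f * sum f ≡ ∑[ v < n ] ∑[ w < n ] (f v * f w)
  sum²≡∑∑ = trans (*-distribʳ-sum (sum f) f) (sum-cong-≗ (λ v → *-distribˡ-sum (f v) f))
  *-distribˡ-∑∑ : ∀ c (g : Fin n → Fin n → ℕ) → c * ∑[ v < n ] ∑[ w < n ] g v w ≡ ∑[ v < n ] ∑[ w < n ] (c * g v w)
  *-distribˡ-∑∑ c g = trans (*-distribˡ-sum c (λ v → ∑[ w < n ] g v w)) (sum-cong-≗ (λ v → *-distribˡ-sum c (g v)))

module _ {N n : ℕ} (f : Fin N → Fin n) where

  collisions : ℕ
  collisions = ∑[ x < N ] ∑[ y < N ] indicator (f x Fin.≟ f y)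

  fibre : Fin n → ℕ
  fibre v = ∑[ x < N ] indicator (f x Fin.≟ v)

  ∑-fibre : ∑[ v < n ] fibre v ≡ N
  ∑-fibre = begin
    ∑[ v < n ] ∑[ x < N ] indicator (f x Fin.≟ v)          ≡⟨ ∑-comm (λ v x → indicator (f x Fin.≟ v)) ⟩
    ∑[ x < N ] ∑[ v < n ] indicator (f x Fin.≟ v)          ≡⟨ sum-cong-≗ (λ x → sum-cong-≗ (λ v → *-identityˡ (indicator (f x Fin.≟ v)))) ⟨
    ∑[ x < N ] ∑[ v < n ] (1 * indicator (f x Fin.≟ v))    ≡⟨ sum-cong-≗ (λ x → ∑-*-indicator-≟ (λ _ → 1) (f x)) ⟩
    ∑[ x < N ] 1                                           ≡⟨ sum-const N 1 ⟩
    N * 1                                                  ≡⟨ *-identityʳ N ⟩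
    N                                                      ∎
    where open ≡-Reasoning

  collisions≡∑fibre² : collisions ≡ ∑[ v < n ] (fibre v * fibre v)
  collisions≡∑fibre² = begin
    ∑[ x < N ] ∑[ y < N ] indicator (f x Fin.≟ f y)                ≡⟨ sum-cong-≗ (λ x → sum-cong-≗ (λ y →
                                                                        ∑-*-indicator-≟ (λ v → indicator (f x Fin.≟ v)) (f y))) ⟨
    ∑[ x < N ] ∑[ y < N ] ∑[ v < n ] ([ x ∈ v ] * [ y ∈ v ])       ≡⟨ sum-cong-≗ (λ x → ∑-comm (λ y v → [ x ∈ v ] * [ y ∈ v ])) ⟩
    ∑[ x < N ] ∑[ v < n ] ∑[ y < N ] ([ x ∈ v ] * [ y ∈ v ])       ≡⟨ ∑-comm (λ x v → ∑[ y < N ] ([ x ∈ v ] * [ y ∈ v ])) ⟩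
    ∑[ v < n ] ∑[ x < N ] ∑[ y < N ] ([ x ∈ v ] * [ y ∈ v ])       ≡⟨ sum-cong-≗ (λ v → sum-cong-≗ (λ x → *-distribˡ-sum [ x ∈ v ] (λ y → [ y ∈ v ]))) ⟨
    ∑[ v < n ] ∑[ x < N ] ([ x ∈ v ] * fibre v)                    ≡⟨ sum-cong-≗ (λ v → *-distribʳ-sum (fibre v) (λ x → [ x ∈ v ])) ⟨
    ∑[ v < n ] (fibre v * fibre v)                                 ∎
    where
    open ≡-Reasoning
    [_∈_] : Fin N → Fin n → ℕ
    [ x ∈ v ] = indicator (f x Fin.≟ v)

  collisions-lowerBound : N * N ≤ n * collisions
  collisions-lowerBound = begin
    N * N                                ≡⟨ cong₂ _*_ ∑-fibre ∑-fibre ⟨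
    sum fibre * sum fibre                ≤⟨ cauchy-schwarz n fibre ⟩
    n * ∑[ v < n ] (fibre v * fibre v)   ≡⟨ cong (n *_) collisions≡∑fibre² ⟨
    n * collisions                       ∎
    where open ≤-Reasoning

-- Fixed points of involutions

odd≢even : ∀ k a → suc (k + k) ≢ a + a
odd≢even zero    zero    ()
odd≢even zero    (suc a) e = 1+n≢0 (sym (trans (suc-injective e) (+-suc a a)))
odd≢even (suc k) zero    ()
odd≢even (suc k) (suc a) e =
  odd≢even k a (suc-injective (trans (cong suc (sym (+-suc k k))) (trans (suc-injective e) (+-suc a a))))

fixedPointFree-involution⇒even : ∀ {n} (h : Fin n → Fin n) → (∀ j → h (h j) ≡ j) → (∀ j → h j ≢ j) →
                                 ∃ λ a → n ≡ a + a
fixedPointFree-involution⇒even {n} h h∘h≡id h≢id = a , (begin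
  n                                     ≡⟨ trans (sym (*-identityʳ n)) (sym (sum-const n 1)) ⟩
  ∑[ j < n ] 1                          ≡⟨ sum-cong-≗ ascent+descent≡1 ⟨
  ∑[ j < n ] (ascent j + descent j)     ≡⟨ ∑-distrib-+ ascent descent ⟩
  a + ∑[ j < n ] descent j              ≡⟨ cong (a +_) descents≡ascents ⟩
  a + a                                 ∎)
  where
  open ≡-Reasoning
  ascent descent : Fin n → ℕ
  ascent  j = indicator (j Fin.<? h j)
  descent j = indicator (h j Fin.<? j)
  a = ∑[ j < n ] ascent j
  ascent+descent≡1 : ∀ j → ascent j + descent j ≡ 1
  ascent+descent≡1 j with Fin.<-cmp j (h j) | j Fin.<? h j | h j Fin.<? j
  ... | tri< _ _ _     | yes _    | no _     = refl
  ... | tri< j<hj _ _  | no j≮hj  | _        = contradiction j<hj j≮hj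
  ... | tri< _ _ hj≮j  | _        | yes hj<j = contradiction hj<j hj≮j
  ... | tri≈ _ j≡hj _  | _        | _        = contradiction (sym j≡hj) (h≢id j)
  ... | tri> _ _ _     | no _     | yes _    = refl
  ... | tri> _ _ hj<j  | _        | no hj≮j  = contradiction hj<j hj≮j
  ... | tri> j≮hj _ _  | yes j<hj | _        = contradiction j<hj j≮hj
  descents≡ascents : ∑[ j < n ] descent j ≡ a
  descents≡ascents = trans (sum-permute descent (permutation h h h∘h≡id h∘h≡id))
                           (sum-cong-≗ (λ j → cong (λ i → indicator (i Fin.<? h j)) (h∘h≡id j)))

involution⇒∃-fixedPoint : ∀ k (h : Fin (suc (k + k)) → Fin (suc (k + k))) → (∀ j → h (h j) ≡ j) →
                          ∃ λ j → h j ≡ j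
involution⇒∃-fixedPoint k h h∘h≡id with Fin.any? (λ j → h j Fin.≟ j)
... | yes fixedPoint = fixedPoint
... | no  noFixedPoint =
  let a , odd≡even = fixedPointFree-involution⇒even h h∘h≡id (λ j hj≡j → noFixedPoint (j , hj≡j))
  in contradiction odd≡even (odd≢even k a)

-- Congruence modulo q

module Congruence (q : ℕ) .{{_ : NonZero q}} where

  infix 4 _≈_
  record _≈_ (x y : ℕ) : Set where
    constructor mk≈
    field %≡% : x % q ≡ y % q

  ≈-isEquivalence : IsEquivalence _≈_
  ≈-isEquivalence = record
    { refl  = mk≈ refl
    ; sym   = λ (mk≈ e) → mk≈ (sym e)
    ; trans = λ (mk≈ e) (mk≈ f) → mk≈ (trans e f)
    }

  ≈-setoid : Setoid 0ℓ 0ℓ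
  ≈-setoid = record { isEquivalence = ≈-isEquivalence }

  open IsEquivalence ≈-isEquivalence public
    using () renaming (refl to ≈-refl; sym to ≈-sym; trans to ≈-trans; reflexive to ≡⇒≈)

  module ≈-Reasoning = SetoidReasoning ≈-setoid

  +-cong : ∀ {x x′ y y′} → x ≈ x′ → y ≈ y′ → x + y ≈ x′ + y′
  +-cong {x} {x′} {y} {y′} (mk≈ e) (mk≈ f) = mk≈ (begin
    (x + y) % q             ≡⟨ %-distribˡ-+ x y q ⟩
    (x % q + y % q) % q     ≡⟨ cong₂ (λ u v → (u + v) % q) e f ⟩
    (x′ % q + y′ % q) % q   ≡⟨ %-distribˡ-+ x′ y′ q ⟨
    (x′ + y′) % q           ∎)
    where open ≡-Reasoning

  *-cong : ∀ {x x′ y y′} → x ≈ x′ → y ≈ y′ → x * y ≈ x′ * y′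
  *-cong {x} {x′} {y} {y′} (mk≈ e) (mk≈ f) = mk≈ (begin
    (x * y) % q             ≡⟨ %-distribˡ-* x y q ⟩
    (x % q * (y % q)) % q   ≡⟨ cong₂ (λ u v → (u * v) % q) e f ⟩
    (x′ % q * (y′ % q)) % q ≡⟨ %-distribˡ-* x′ y′ q ⟨
    (x′ * y′) % q           ∎)
    where open ≡-Reasoning

  ^-cong : ∀ {x y} n → x ≈ y → x ^ n ≈ y ^ n
  ^-cong zero    _   = ≈-refl
  ^-cong (suc n) x≈y = *-cong x≈y (^-cong n x≈y)

  %-≈ : ∀ x → x % q ≈ x
  %-≈ x = mk≈ (m%n%n≡m%n x q)

  0%q≡0 : 0 % q ≡ 0
  0%q≡0 = m*n%n≡0 0 q

  ∣⇒≈0 : ∀ {x} → q ∣ x → x ≈ 0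
  ∣⇒≈0 {x} q∣x = mk≈ (trans (n∣m⇒m%n≡0 x q q∣x) (sym 0%q≡0))

  ≈0⇒∣ : ∀ {x} → x ≈ 0 → q ∣ x
  ≈0⇒∣ {x} (mk≈ e) = m%n≡0⇒n∣m x q (trans e 0%q≡0)

  ≈⇒≡ : ∀ {x y} → x < q → y < q → x ≈ y → x ≡ y
  ≈⇒≡ x<q y<q (mk≈ e) = trans (sym (m<n⇒m%n≡m x<q)) (trans e (m<n⇒m%n≡m y<q))

  +-cancelʳ-≈ : ∀ {x y} z → x + z ≈ y + z → x ≈ y
  +-cancelʳ-≈ {x} {y} z x+z≈y+z = begin
    x             ≡⟨ +-identityʳ x ⟨
    x + 0         ≈⟨ +-cong (≈-refl {x}) (≈-sym z+c≈0) ⟩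
    x + (z + c)   ≡⟨ +-assoc x z c ⟨
    x + z + c     ≈⟨ +-cong x+z≈y+z (≈-refl {c}) ⟩
    y + z + c     ≡⟨ +-assoc y z c ⟩
    y + (z + c)   ≈⟨ +-cong (≈-refl {y}) z+c≈0 ⟩
    y + 0         ≡⟨ +-identityʳ y ⟩
    y             ∎
    where
    open ≈-Reasoning
    c = q ∸ z % q
    z+c≈0 : z + c ≈ 0
    z+c≈0 = begin
      z + c       ≈⟨ +-cong (≈-sym (%-≈ z)) (≈-refl {c}) ⟩
      z % q + c   ≡⟨ m+[n∸m]≡n (m%n≤n z q) ⟩
      q           ≈⟨ ∣⇒≈0 ∣-refl ⟩
      0           ∎

  m*q≈0 : ∀ k → k * q ≈ 0
  m*q≈0 k = ∣⇒≈0 (n∣m*n k)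

  m+1≈0⇒m*[q∸1]≈1 : ∀ {u} → u + 1 ≈ 0 → u * (q ∸ 1) ≈ 1
  m+1≈0⇒m*[q∸1]≈1 {u} u+1≈0 = +-cancelʳ-≈ u (begin
    u * (q ∸ 1) + u   ≡⟨ +-comm (u * (q ∸ 1)) u ⟩
    u + u * (q ∸ 1)   ≡⟨ *-suc u (q ∸ 1) ⟨
    u * suc (q ∸ 1)   ≡⟨ cong (u *_) (m+[n∸m]≡n (>-nonZero⁻¹ q)) ⟩
    u * q             ≈⟨ m*q≈0 u ⟩
    0                 ≈⟨ ≈-sym u+1≈0 ⟩
    u + 1             ≡⟨ +-comm u 1 ⟩
    1 + u             ∎)
    where open ≈-Reasoning

  [q∸r]²≈r² : ∀ {r} → r ≤ q → (q ∸ r) * (q ∸ r) ≈ r * r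
  [q∸r]²≈r² {r} r≤q = +-cancelʳ-≈ (w * r) (begin
    w * w + w * r   ≡⟨ *-distribˡ-+ w w r ⟨
    w * (w + r)     ≡⟨ cong (w *_) w+r≡q ⟩
    w * q           ≈⟨ m*q≈0 w ⟩
    0               ≈⟨ ≈-sym (m*q≈0 r) ⟩
    r * q           ≡⟨ cong (r *_) w+r≡q ⟨
    r * (w + r)     ≡⟨ trans (*-distribˡ-+ r w r) (trans (+-comm (r * w) (r * r)) (cong (r * r +_) (*-comm r w))) ⟩
    r * r + w * r   ∎)
    where
    open ≈-Reasoning
    w = q ∸ r
    w+r≡q : w + r ≡ q
    w+r≡q = m∸n+n≡m r≤q

  x+z≈y⇒[x≈0⇔y≈z] : ∀ {x y z} → x + z ≈ y → x ≈ 0 ⇔ y ≈ z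
  x+z≈y⇒[x≈0⇔y≈z] {x} {y} {z} x+z≈y = mk⇔
    (λ x≈0 → ≈-trans (≈-sym x+z≈y) (+-cong x≈0 (≈-refl {z})))
    (λ y≈z → +-cancelʳ-≈ z (≈-trans x+z≈y y≈z))

  %≡0⇔≈0 : ∀ {x} → x % q ≡ 0 ⇔ x ≈ 0
  %≡0⇔≈0 = mk⇔ (λ x%q≡0 → mk≈ (trans x%q≡0 (sym 0%q≡0))) (λ (mk≈ e) → trans e 0%q≡0)

  mod≡mod⇔≈ : ∀ {x y} → x mod q ≡ y mod q ⇔ x ≈ y
  mod≡mod⇔≈ {x} {y} = mk⇔
    (λ e → mk≈ (trans (sym (Fin.toℕ-fromℕ< _)) (trans (cong toℕ e) (Fin.toℕ-fromℕ< _))))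
    (λ (mk≈ e) → Fin.toℕ-injective (trans (Fin.toℕ-fromℕ< _) (trans e (sym (Fin.toℕ-fromℕ< _)))))

  infixr 7 _·_
  _·_ : ℕ → Fin q → Fin q
  c · x = (c * toℕ x) mod q

  toℕ-· : ∀ c x → toℕ (c · x) ≈ c * toℕ x
  toℕ-· c x = ≈-trans (≡⇒≈ (Fin.toℕ-fromℕ< _)) (%-≈ (c * toℕ x))

  ·-inverse : ∀ c c′ → c * c′ ≈ 1 → ∀ x → c′ · (c · x) ≡ x
  ·-inverse c c′ cc′≈1 x = Fin.toℕ-injective (≈⇒≡ (Fin.toℕ<n (c′ · (c · x))) (Fin.toℕ<n x) (begin
    toℕ (c′ · (c · x))     ≈⟨ toℕ-· c′ (c · x) ⟩
    c′ * toℕ (c · x)       ≈⟨ *-cong (≈-refl {c′}) (toℕ-· c x) ⟩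
    c′ * (c * toℕ x)       ≡⟨ trans (sym (*-assoc c′ c (toℕ x))) (cong (_* toℕ x) (*-comm c′ c)) ⟩
    c * c′ * toℕ x         ≈⟨ *-cong cc′≈1 (≈-refl {toℕ x}) ⟩
    1 * toℕ x              ≡⟨ *-identityˡ (toℕ x) ⟩
    toℕ x                  ∎))
    where open ≈-Reasoning

  ≈-cong-⇔ : ∀ {x x′ y y′} → x ≈ x′ → y ≈ y′ → x ≈ y ⇔ x′ ≈ y′
  ≈-cong-⇔ x≈x′ y≈y′ = mk⇔ (λ x≈y → ≈-trans (≈-sym x≈x′) (≈-trans x≈y y≈y′))
                           (λ x′≈y′ → ≈-trans x≈x′ (≈-trans x′≈y′ (≈-sym y≈y′)))

  scalePermute : ∀ {n} (σ : Permutation′ n) (s s⁻¹ : Fin n → ℕ) → (∀ j → s j * s⁻¹ j ≈ 1) →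
                 Vec (Fin q) n ↔ Vec (Fin q) n
  scalePermute {n} σ s s⁻¹ ss⁻¹≈1 = mk↔ₛ′ to from to∘from from∘to
    where
    to from : Vec (Fin q) n → Vec (Fin q) n
    to   v = tabulate (λ j → s j · lookup v (σ ⟨$⟩ʳ j))
    from w = tabulate (λ k → s⁻¹ (σ ⟨$⟩ˡ k) · lookup w (σ ⟨$⟩ˡ k))
    to∘from : ∀ w → to (from w) ≡ w
    to∘from w = trans (tabulate-cong λ j → begin
      s j · lookup (from w) (σ ⟨$⟩ʳ j)                           ≡⟨ cong (s j ·_) (lookup∘tabulate _ (σ ⟨$⟩ʳ j)) ⟩
      s j · s⁻¹ (σ ⟨$⟩ˡ (σ ⟨$⟩ʳ j)) · lookup w (σ ⟨$⟩ˡ (σ ⟨$⟩ʳ j)) ≡⟨ cong (λ k → s j · s⁻¹ k · lookup w k) (inverseˡ σ) ⟩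
      s j · s⁻¹ j · lookup w j                                   ≡⟨ ·-inverse (s⁻¹ j) (s j) (≈-trans (≡⇒≈ (*-comm (s⁻¹ j) (s j))) (ss⁻¹≈1 j)) (lookup w j) ⟩
      lookup w j                                                 ∎)
      (tabulate∘lookup w)
      where open ≡-Reasoning
    from∘to : ∀ v → from (to v) ≡ v
    from∘to v = trans (tabulate-cong λ k → let k′ = σ ⟨$⟩ˡ k in begin
      s⁻¹ k′ · lookup (to v) k′                    ≡⟨ cong (s⁻¹ k′ ·_) (lookup∘tabulate _ k′) ⟩
      s⁻¹ k′ · s k′ · lookup v (σ ⟨$⟩ʳ k′)         ≡⟨ ·-inverse (s k′) (s⁻¹ k′) (ss⁻¹≈1 k′) _ ⟩
      lookup v (σ ⟨$⟩ʳ k′)                         ≡⟨ cong (lookup v) (inverseʳ σ) ⟩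
      lookup v k                                   ∎)
      (tabulate∘lookup v)
      where open ≡-Reasoning

  module _ (q-prime : Prime q) where

    1≉0 : ¬ 1 ≈ 0
    1≉0 1≈0 = ¬prime[1] (subst Prime (∣1⇒≡1 (≈0⇒∣ 1≈0)) q-prime)

    *-≈0 : ∀ x y → x * y ≈ 0 → x ≈ 0 ⊎ y ≈ 0
    *-≈0 x y xy≈0 = Sum.map ∣⇒≈0 ∣⇒≈0 (euclidsLemma x y q-prime (≈0⇒∣ xy≈0))

    *-≉0 : ∀ {x y} → ¬ x ≈ 0 → ¬ y ≈ 0 → ¬ x * y ≈ 0
    *-≉0 {x} {y} x≉0 y≉0 xy≈0 = Sum.[ x≉0 , y≉0 ]′ (*-≈0 x y xy≈0)

    ∃-inverse-below : ∀ {r} .{{_ : NonZero r}} → r < q → ∃ λ y → r * y ≈ 1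
    ∃-inverse-below {r} r<q with coprime-Bézout (prime⇒coprime q-prime r<q)
    ... | GCD.Bézout.-+ a b 1+aq≡br = b , (begin
      r * b       ≡⟨ *-comm r b ⟩
      b * r       ≡⟨ 1+aq≡br ⟨
      1 + a * q   ≈⟨ +-cong (≈-refl {1}) (m*q≈0 a) ⟩
      1           ∎)
      where open ≈-Reasoning
    ... | GCD.Bézout.+- a b 1+br≡aq =
      b * (q ∸ 1) , ≈-trans (≡⇒≈ (sym (*-assoc r b (q ∸ 1)))) (m+1≈0⇒m*[q∸1]≈1 (begin
        r * b + 1   ≡⟨ trans (+-comm (r * b) 1) (cong (1 +_) (*-comm r b)) ⟩
        1 + b * r   ≡⟨ 1+br≡aq ⟩
        a * q       ≈⟨ m*q≈0 a ⟩
        0           ∎))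
      where open ≈-Reasoning

    ∃-inverse : ∀ {x} → ¬ x ≈ 0 → ∃ λ y → x * y ≈ 1
    ∃-inverse {x} x≉0 =
      let y , ry≈1 = ∃-inverse-below {{≢-nonZero x%q≢0}} (m%n<n x q)
      in y , ≈-trans (*-cong (≈-sym (%-≈ x)) (≈-refl {y})) ry≈1
      where
      x%q≢0 : x % q ≢ 0
      x%q≢0 x%q≡0 = x≉0 (mk≈ (trans x%q≡0 (sym 0%q≡0)))

    square≈1⇒≈±1 : ∀ {u} → u * u ≈ 1 → u ≈ 1 ⊎ u + 1 ≈ 0
    square≈1⇒≈±1 {zero}  0≈1 = ⊥-elim (1≉0 (≈-sym 0≈1))
    square≈1⇒≈±1 {suc v} u²≈1 = Sum.map v≈0⇒u≈1 v+2≈0⇒u+1≈0 (*-≈0 v (v + 2) v[v+2]≈0)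
      where
      open ≈-Reasoning
      v[v+2]≈0 : v * (v + 2) ≈ 0
      v[v+2]≈0 = +-cancelʳ-≈ 1 (begin
        v * (v + 2) + 1     ≡⟨ solve (v ∷ []) ⟩
        suc v * suc v       ≈⟨ u²≈1 ⟩
        1                   ∎)
      v≈0⇒u≈1 : v ≈ 0 → suc v ≈ 1
      v≈0⇒u≈1 = +-cong (≈-refl {1})
      v+2≈0⇒u+1≈0 : v + 2 ≈ 0 → suc v + 1 ≈ 0
      v+2≈0⇒u+1≈0 = ≈-trans (≡⇒≈ (sym (+-suc v 1)))

-- Square roots of −1 modulo a prime q ≡ 1 (mod 4)

module HalfResidues (m : ℕ) (q-prime : Prime (suc (m + m))) where

  private
    q : ℕ
    q = suc (m + m)

  open Congruence q

  ≤m⇒<q : ∀ {a} → a ≤ m → a < q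
  ≤m⇒<q a≤m = s≤s (≤-trans a≤m (m≤m+n m m))

  ≈0⇒≡0 : ∀ {a} → a < q → a ≈ 0 → a ≡ 0
  ≈0⇒≡0 a<q = ≈⇒≡ a<q 0<1+n

  square-injective-≤ : ∀ {a b} → a ≤ b → b ≤ m → b * b ≈ a * a → b ≡ a
  square-injective-≤ {a} a≤b b≤m b²≈a² with m≤n⇒∃[o]m+o≡n a≤b
  ... | d , refl = trans (cong (a +_) d≡0) (+-identityʳ a)
    where
    d[d+2a]≈0 : d * (d + 2 * a) ≈ 0
    d[d+2a]≈0 = +-cancelʳ-≈ (a * a) (begin
      d * (d + 2 * a) + a * a   ≡⟨ solve (a ∷ d ∷ []) ⟩
      (a + d) * (a + d)         ≈⟨ b²≈a² ⟩
      a * a                     ∎)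
      where open ≈-Reasoning
    d+2a<q : d + 2 * a < q
    d+2a<q = s≤s (begin
      d + 2 * a                 ≤⟨ m≤m+n (d + 2 * a) d ⟩
      d + 2 * a + d             ≡⟨ solve (a ∷ d ∷ []) ⟩
      (a + d) + (a + d)         ≤⟨ +-mono-≤ b≤m b≤m ⟩
      m + m                     ∎)
      where open ≤-Reasoning
    d≡0 : d ≡ 0
    d≡0 with *-≈0 q-prime d (d + 2 * a) d[d+2a]≈0
    ... | inj₁ d≈0    = ≈0⇒≡0 (≤m⇒<q (≤-trans (m≤n+m d a) b≤m)) d≈0
    ... | inj₂ d+2a≈0 = m+n≡0⇒m≡0 d (≈0⇒≡0 d+2a<q d+2a≈0)

  square-injective : ∀ {a b} → a ≤ m → b ≤ m → a * a ≈ b * b → a ≡ b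
  square-injective {a} {b} a≤m b≤m a²≈b² with ≤-total a b
  ... | inj₁ a≤b = sym (square-injective-≤ a≤b b≤m (≈-sym a²≈b²))
  ... | inj₂ b≤a = square-injective-≤ b≤a a≤m a²≈b²

  -- (x z)² ≡ 1, which for prime q means x z ≡ ±1.
  InverseUpToSign : ℕ → ℕ → Set
  InverseUpToSign x z = x * z * (x * z) ≈ 1

  InverseUpToSign-sym : ∀ {x z} → InverseUpToSign x z → InverseUpToSign z x
  InverseUpToSign-sym {x} {z} = subst (λ u → u * u ≈ 1) (*-comm x z)

  InverseUpToSign⇒square≈ : ∀ {x y z} → x * y ≈ 1 → InverseUpToSign x z → z * z ≈ y * y
  InverseUpToSign⇒square≈ {x} {y} {z} xy≈1 [xz]²≈1 = begin
    z * z                       ≡⟨ *-identityʳ (z * z) ⟨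
    z * z * 1                   ≈⟨ *-cong (≈-refl {z * z}) (*-cong (≈-sym xy≈1) (≈-sym xy≈1)) ⟩
    z * z * (x * y * (x * y))   ≡⟨ solve (x ∷ y ∷ z ∷ []) ⟩
    x * z * (x * z) * (y * y)   ≈⟨ *-cong [xz]²≈1 (≈-refl {y * y}) ⟩
    1 * (y * y)                 ≡⟨ *-identityˡ (y * y) ⟩
    y * y                       ∎
    where open ≈-Reasoning

  ∃-representative : ∀ {x} → ¬ x ≈ 0 → ∃ λ z → 0 < z × z ≤ m × InverseUpToSign x z
  ∃-representative {x} x≉0 =
    let y , xy≈1 = ∃-inverse q-prime x≉0
    in fold (m%n<n y q) (≈-trans (*-cong (≈-refl {x}) (%-≈ y)) xy≈1)
    where
    fold : ∀ {r} → r < q → x * r ≈ 1 → ∃ λ z → 0 < z × z ≤ m × InverseUpToSign x z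
    fold {r} r<q xr≈1 with r ≤? m
    ... | yes r≤m = r , n≢0⇒n>0 r≢0 , r≤m , *-cong xr≈1 xr≈1
      where
      r≢0 : r ≢ 0
      r≢0 refl = 1≉0 q-prime (≈-trans (≈-sym xr≈1) (≡⇒≈ (*-zeroʳ x)))
    ... | no r≰m = q ∸ r , m<n⇒0<n∸m r<q , q∸r≤m , (begin
      x * (q ∸ r) * (x * (q ∸ r))   ≡⟨ [ab][ab]≡[aa][bb] x (q ∸ r) ⟩
      x * x * ((q ∸ r) * (q ∸ r))   ≈⟨ *-cong (≈-refl {x * x}) ([q∸r]²≈r² (<⇒≤ r<q)) ⟩
      x * x * (r * r)               ≡⟨ [ab][ab]≡[aa][bb] x r ⟨
      x * r * (x * r)               ≈⟨ *-cong xr≈1 xr≈1 ⟩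
      1                             ∎)
      where
      open ≈-Reasoning
      [ab][ab]≡[aa][bb] : ∀ a b → a * b * (a * b) ≡ a * a * (b * b)
      [ab][ab]≡[aa][bb] a b = solve (a ∷ b ∷ [])
      q∸r≤m : q ∸ r ≤ m
      q∸r≤m = ≤-trans (∸-monoʳ-≤ q (≰⇒> r≰m)) (≤-reflexive (m+n∸n≡m m m))

  representative-unique : ∀ {x z z′} → ¬ x ≈ 0 → z ≤ m → z′ ≤ m →
                          InverseUpToSign x z → InverseUpToSign x z′ → z ≡ z′
  representative-unique {x} {z} {z′} x≉0 z≤m z′≤m xz≈±1 xz′≈±1 =
    let y , xy≈1 = ∃-inverse q-prime x≉0
    in square-injective z≤m z′≤m
         (≈-trans (InverseUpToSign⇒square≈ {x} {y} {z} xy≈1 xz≈±1)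
                  (≈-sym (InverseUpToSign⇒square≈ {x} {y} {z′} xy≈1 xz′≈±1)))

  -- Fin (pred m) enumerates the residues 2, …, m.
  residue : Fin (pred m) → ℕ
  residue j = 2 + toℕ j

  residue-injective : ∀ {i j} → residue i ≡ residue j → i ≡ j
  residue-injective = Fin.toℕ-injective ∘ suc-injective ∘ suc-injective

  residue≤m : ∀ j → residue j ≤ m
  residue≤m j = <pred⇒2+≤ (Fin.toℕ<n j)
    where
    <pred⇒2+≤ : ∀ {t n} → t < pred n → 2 + t ≤ n
    <pred⇒2+≤ {n = suc n} t<n = s≤s t<n

  residue≉0 : ∀ j → ¬ residue j ≈ 0
  residue≉0 j r≈0 = 1+n≢0 (≈0⇒≡0 (≤m⇒<q (residue≤m j)) r≈0)

  1≤m : ∀ j → 1 ≤ m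
  1≤m j = ≤-trans (s≤s z≤n) (residue≤m j)

  ∃-partner : ∀ j → ∃ λ j′ → InverseUpToSign (residue j) (residue j′)
  ∃-partner j = from-representative (∃-representative (residue≉0 j))
    where
    from-representative : (∃ λ z → 0 < z × z ≤ m × InverseUpToSign (residue j) z) →
                          ∃ λ j′ → InverseUpToSign (residue j) (residue j′)
    -- z = 1 would make both residue j and 1 representatives for the inverse of 1.
    from-representative (suc zero , _ , _ , xz≈±1) =
      contradiction (representative-unique {1} {residue j} {1} (1≉0 q-prime) (residue≤m j) (1≤m j)
                                           (InverseUpToSign-sym {residue j} {1} xz≈±1) ≈-refl)
                    (1+n≢0 ∘ suc-injective)
    from-representative (suc (suc w) , _ , z≤m , xz≈±1) =
      fromℕ< w<pred[m] , subst (InverseUpToSign (residue j)) (cong (2 +_) (sym (Fin.toℕ-fromℕ< w<pred[m]))) xz≈±1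
      where
      w<pred[m] : w < pred m
      w<pred[m] = <⇒≤pred z≤m

  partner : Fin (pred m) → Fin (pred m)
  partner j = proj₁ (∃-partner j)

  partner-involutive : ∀ j → partner (partner j) ≡ j
  partner-involutive j = residue-injective
    (representative-unique {residue (partner j)} (residue≉0 (partner j)) (residue≤m _) (residue≤m j)
      (proj₂ (∃-partner (partner j))) (InverseUpToSign-sym {residue j} (proj₂ (∃-partner j))))

  partner-fixed⇒square≈-1 : ∀ j → partner j ≡ j → residue j * residue j + 1 ≈ 0
  partner-fixed⇒square≈-1 j pj≡j = Sum.[ ⊥-elim ∘ x²≉1 , id ]′ (square≈1⇒≈±1 q-prime x⁴≈1)
    where
    x⁴≈1 : InverseUpToSign (residue j) (residue j)
    x⁴≈1 = subst (λ i → InverseUpToSign (residue j) (residue i)) pj≡j (proj₂ (∃-partner j))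
    x²≉1 : ¬ residue j * residue j ≈ 1
    x²≉1 x²≈1 = contradiction (square-injective (residue≤m j) (1≤m j) x²≈1) (1+n≢0 ∘ suc-injective)

∃-sqrt[-1] : ∀ {q} → Prime q → q % 4 ≡ 1 → ∃ λ i → q ∣ i * i + 1
∃-sqrt[-1] {q} q-prime q%4≡1 with q / 4 | m≡m%n+[m/n]*n q 4
... | zero  | q≡1 = contradiction (subst Prime (trans q≡1 (cong (_+ 0) q%4≡1)) q-prime) ¬prime[1]
... | suc k | q≡ = subst (λ n → ∃ λ i → n ∣ i * i + 1) (sym q≡m+m+1) sqrt
  where
  m = 2 + (k + k)
  q≡m+m+1 : q ≡ suc (m + m)
  q≡m+m+1 = trans q≡ (trans (cong (_+ suc k * 4) q%4≡1) 1+[1+k]*4≡m+m+1)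
    where
    1+[1+k]*4≡m+m+1 : 1 + suc k * 4 ≡ suc (2 + (k + k) + (2 + (k + k)))
    1+[1+k]*4≡m+m+1 = solve (k ∷ [])
  open HalfResidues m (subst Prime q≡m+m+1 q-prime)
  open Congruence (suc (m + m)) using (≈0⇒∣)
  -- pred m = suc (k + k), so partner is an involution of a set of odd size.
  sqrt : ∃ λ i → suc (m + m) ∣ i * i + 1
  sqrt = let j , pj≡j = involution⇒∃-fixedPoint k partner partner-involutive
         in residue j , ≈0⇒∣ (partner-fixed⇒square≈-1 j pj≡j)

∃-fourthRoot[-4] : ∀ {q} → Prime q → q % 4 ≡ 1 → ∃ λ t → q ∣ t ^ 4 + 4
∃-fourthRoot[-4] {q} q-prime q%4≡1 =
  let i , q∣i²+1 = ∃-sqrt[-1] q-prime q%4≡1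
  in 1 + i , subst (q ∣_) (sym ([1+i]⁴+4≡[i²+1][i²+4i+5] i)) (∣m⇒∣m*n (i * i + 4 * i + 5) q∣i²+1)
  where
  open +-*-Solver using (_:+_; _:*_; _:^_; _:=_; con)
  [1+i]⁴+4≡[i²+1][i²+4i+5] : ∀ i → (1 + i) ^ 4 + 4 ≡ (i * i + 1) * (i * i + 4 * i + 5)
  [1+i]⁴+4≡[i²+1][i²+4i+5] = +-*-Solver.solve 1
    (λ i → (con 1 :+ i) :^ 4 :+ con 4 := (i :* i :+ con 1) :* (i :* i :+ con 4 :* i :+ con 5)) refl

prime≡1[mod4]⇒∤4 : ∀ {q} → Prime q → q % 4 ≡ 1 → ¬ q ∣ 4
prime≡1[mod4]⇒∤4 q-prime q%4≡1 q∣4 = ≤4⇒¬prime≡1[mod4] q-prime q%4≡1 (∣⇒≤ q∣4)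
  where
  ≤4⇒¬prime≡1[mod4] : ∀ {q} → Prime q → q % 4 ≡ 1 → ¬ q ≤ 4
  ≤4⇒¬prime≡1[mod4] {0} _ () _
  ≤4⇒¬prime≡1[mod4] {1} p _ _ = ¬prime[1] p
  ≤4⇒¬prime≡1[mod4] {2} _ () _
  ≤4⇒¬prime≡1[mod4] {3} _ () _
  ≤4⇒¬prime≡1[mod4] {4} _ () _
  ≤4⇒¬prime≡1[mod4] {suc (suc (suc (suc (suc _))))} _ _ (s≤s (s≤s (s≤s (s≤s ()))))

-- Sums over (ℤ/qℤ)ⁿ

length∘filter≡sum∘map-indicator : ∀ {a p} {A : Set a} {P : Pred A p} (P? : Decidable P) xs →
                                  List.length (List.filter P? xs) ≡ sumᴸ (List.map (indicator ∘ P?) xs)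
length∘filter≡sum∘map-indicator P? []       = refl
length∘filter≡sum∘map-indicator P? (x ∷ xs) with P? x
... | yes _ = cong suc (length∘filter≡sum∘map-indicator P? xs)
... | no  _ = length∘filter≡sum∘map-indicator P? xs

sum∘map-cartesianProductWith : ∀ {a b c} {A : Set a} {B : Set b} {C : Set c} (f : A → B → C) (g : C → ℕ) xs ys →
  sumᴸ (List.map g (List.cartesianProductWith f xs ys)) ≡ sumᴸ (List.map (λ x → sumᴸ (List.map (g ∘ f x) ys)) xs)
sum∘map-cartesianProductWith f g []       ys = refl
sum∘map-cartesianProductWith f g (x ∷ xs) ys = begin
  sumᴸ (List.map g (List.map (f x) ys List.++ List.cartesianProductWith f xs ys))
    ≡⟨ cong sumᴸ (List.map-++ g (List.map (f x) ys) _) ⟩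
  sumᴸ (List.map g (List.map (f x) ys) List.++ List.map g (List.cartesianProductWith f xs ys))
    ≡⟨ sumᴸ-++ (List.map g (List.map (f x) ys)) _ ⟩
  sumᴸ (List.map g (List.map (f x) ys)) + sumᴸ (List.map g (List.cartesianProductWith f xs ys))
    ≡⟨ cong₂ _+_ (cong sumᴸ (sym (List.map-∘ ys))) (sum∘map-cartesianProductWith f g xs ys) ⟩
  sumᴸ (List.map (g ∘ f x) ys) + sumᴸ (List.map (λ x → sumᴸ (List.map (g ∘ f x) ys)) xs)
    ∎
  where open ≡-Reasoning

sum∘map-tabulate : ∀ {a} {A : Set a} {n} (f : Fin n → A) (g : A → ℕ) →
                   sumᴸ (List.map g (List.tabulate f)) ≡ ∑[ i < n ] g (f i)
sum∘map-tabulate {n = zero}  f g = refl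
sum∘map-tabulate {n = suc n} f g = cong (g (f zero) +_) (sum∘map-tabulate (f ∘ suc) g)

module _ {q : ℕ} where

  -- Opened locally: overloading them with the list constructors slows the ring solver's variable lists.
  open import Data.Vec using ([]; _∷_)

  ∑ᵛ : ∀ n → (Vec (Fin q) n → ℕ) → ℕ
  ∑ᵛ zero    g = g []
  ∑ᵛ (suc n) g = ∑[ i < q ] ∑ᵛ n (λ v → g (i ∷ v))

  encode : ∀ {n} → Vec (Fin q) n → Fin (q ^ n)
  encode []      = zero
  encode (i ∷ v) = combine i (encode v)

  decode : ∀ n → Fin (q ^ n) → Vec (Fin q) n
  decode zero    _ = []
  decode (suc n) k = proj₁ (remQuot {q} (q ^ n) k) ∷ decode n (proj₂ (remQuot {q} (q ^ n) k))

  decode-combine : ∀ n i k → decode (suc n) (combine i k) ≡ i ∷ decode n k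
  decode-combine n i k = cong (λ p → proj₁ p ∷ decode n (proj₂ p)) (Fin.remQuot-combine {q} {q ^ n} i k)

  decode-encode : ∀ {n} (v : Vec (Fin q) n) → decode n (encode v) ≡ v
  decode-encode []      = refl
  decode-encode (i ∷ v) = trans (decode-combine _ i (encode v)) (cong (i ∷_) (decode-encode v))

  encode-decode : ∀ n k → encode (decode n k) ≡ k
  encode-decode zero    zero = refl
  encode-decode (suc n) k    = trans (cong (combine i) (encode-decode n k′)) (Fin.combine-remQuot {q} (q ^ n) k)
    where
    i  = proj₁ (remQuot {q} (q ^ n) k)
    k′ = proj₂ (remQuot {q} (q ^ n) k)

  ∑ᵛ≡∑∘decode : ∀ n (g : Vec (Fin q) n → ℕ) → ∑ᵛ n g ≡ ∑[ k < q ^ n ] g (decode n k)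
  ∑ᵛ≡∑∘decode zero    g = sym (+-identityʳ (g []))
  ∑ᵛ≡∑∘decode (suc n) g = begin
    ∑[ i < q ] ∑ᵛ n (λ v → g (i ∷ v))                        ≡⟨ sum-cong-≗ (λ i → ∑ᵛ≡∑∘decode n (λ v → g (i ∷ v))) ⟩
    ∑[ i < q ] ∑[ k < q ^ n ] g (i ∷ decode n k)             ≡⟨ sum-cong-≗ (λ i → sum-cong-≗ (λ k → cong g (decode-combine n i k))) ⟨
    ∑[ i < q ] ∑[ k < q ^ n ] g (decode (suc n) (combine i k)) ≡⟨ ∑-combine q (g ∘ decode (suc n)) ⟨
    ∑[ k < q ^ suc n ] g (decode (suc n) k)                  ∎
    where open ≡-Reasoning

  ∑ᵛ-↔ : ∀ n (β : Vec (Fin q) n ↔ Vec (Fin q) n) (g : Vec (Fin q) n → ℕ) → ∑ᵛ n (g ∘ Inverse.to β) ≡ ∑ᵛ n g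
  ∑ᵛ-↔ n β g = begin
    ∑ᵛ n (g ∘ to)                            ≡⟨ ∑ᵛ≡∑∘decode n (g ∘ to) ⟩
    ∑[ k < q ^ n ] g (to (decode n k))       ≡⟨ sum-cong-≗ (λ k → cong g (decode-encode (to (decode n k)))) ⟨
    ∑[ k < q ^ n ] g (decode n (π k))        ≡⟨ sum-permute (g ∘ decode n) (permutation π π⁻¹ π∘π⁻¹ π⁻¹∘π) ⟨
    ∑[ k < q ^ n ] g (decode n k)            ≡⟨ ∑ᵛ≡∑∘decode n g ⟨
    ∑ᵛ n g                                   ∎
    where
    open ≡-Reasoning
    open Inverse β using (to; from; strictlyInverseˡ; strictlyInverseʳ)
    π π⁻¹ : Fin (q ^ n) → Fin (q ^ n)
    π   = encode ∘ to   ∘ decode n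
    π⁻¹ = encode ∘ from ∘ decode n
    π∘π⁻¹ : ∀ k → π (π⁻¹ k) ≡ k
    π∘π⁻¹ k = trans (cong (encode ∘ to) (decode-encode _)) (trans (cong encode (strictlyInverseˡ _)) (encode-decode n k))
    π⁻¹∘π : ∀ k → π⁻¹ (π k) ≡ k
    π⁻¹∘π k = trans (cong (encode ∘ from) (decode-encode _)) (trans (cong encode (strictlyInverseʳ _)) (encode-decode n k))

  sum∘map-allVecs : ∀ n (g : Vec (Fin q) n → ℕ) → sumᴸ (List.map g (allVecs q n)) ≡ ∑ᵛ n g
  sum∘map-allVecs zero    g = +-identityʳ (g [])
  sum∘map-allVecs (suc n) g = begin
    sumᴸ (List.map g (allVecs q (suc n)))
      ≡⟨ sum∘map-cartesianProductWith _∷_ g (List.allFin q) (allVecs q n) ⟩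
    sumᴸ (List.map (λ i → sumᴸ (List.map (λ v → g (i ∷ v)) (allVecs q n))) (List.allFin q))
      ≡⟨ sum∘map-tabulate id (λ i → sumᴸ (List.map (λ v → g (i ∷ v)) (allVecs q n))) ⟩
    ∑[ i < q ] sumᴸ (List.map (λ v → g (i ∷ v)) (allVecs q n))
      ≡⟨ sum-cong-≗ (λ i → sum∘map-allVecs n (λ v → g (i ∷ v))) ⟩
    ∑ᵛ (suc n) g
      ∎
    where open ≡-Reasoning

  ∑ᵛ-cong : ∀ n {g h : Vec (Fin q) n → ℕ} → (∀ v → g v ≡ h v) → ∑ᵛ n g ≡ ∑ᵛ n h
  ∑ᵛ-cong zero    g≗h = g≗h []
  ∑ᵛ-cong (suc n) g≗h = sum-cong-≗ (λ i → ∑ᵛ-cong n (λ v → g≗h (i ∷ v)))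

  ∑ᵛ-collisions : ∀ n {m} (f : Vec (Fin q) n → Fin m) →
                  ∑ᵛ n (λ u → ∑ᵛ n (λ v → indicator (f u Fin.≟ f v))) ≡ collisions (f ∘ decode n)
  ∑ᵛ-collisions n f =
    trans (∑ᵛ≡∑∘decode n (λ u → ∑ᵛ n (λ v → indicator (f u Fin.≟ f v))))
          (sum-cong-≗ (λ k → ∑ᵛ≡∑∘decode n (λ v → indicator (f (decode n k) Fin.≟ f v))))

-- The point count

module PointCount (a b c₁ c₂ c₃ c₄ : ℕ) (σ : Permutation′ 4) {q : ℕ} (q-prime : Prime q)
                  (q%4≡1 : q % 4 ≡ 1) (q∤abc : ¬ q ∣ a * b * c₁ * c₂ * c₃ * c₄) where

  private instance
    q≢0 : NonZero q
    q≢0 = prime⇒nonZero q-prime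

  open Congruence q
  open import Data.Vec using ([]; _∷_)

  Q : ℕ → ℕ → ℕ
  Q u v = a * u ^ 4 + b * v ^ 4

  Q-cong : ∀ {u u′ v v′} → u ≈ u′ → v ≈ v′ → Q u v ≈ Q u′ v′
  Q-cong u≈u′ v≈v′ = +-cong (*-cong (≈-refl {a}) (^-cong 4 u≈u′)) (*-cong (≈-refl {b}) (^-cong 4 v≈v′))

  Q-mod : Vec (Fin q) 2 → Fin q
  Q-mod (u ∷ v ∷ []) = Q (toℕ u) (toℕ v) mod q

  collision : Vec (Fin q) 4 → ℕ
  collision (u₀ ∷ u₁ ∷ v₀ ∷ v₁ ∷ []) = indicator (Q-mod (u₀ ∷ u₁ ∷ []) Fin.≟ Q-mod (v₀ ∷ v₁ ∷ []))

  F+Q[tz,tw]≡Q[x,y]+[t⁴+4]Q[z,w] : ∀ t x y z w →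
    a * x ^ 4 + b * y ^ 4 + 4 * a * z ^ 4 + 4 * b * w ^ 4 + Q (t * z) (t * w) ≡ Q x y + (t ^ 4 + 4) * Q z w
  F+Q[tz,tw]≡Q[x,y]+[t⁴+4]Q[z,w] t x y z w = +-*-Solver.solve 7
    (λ a b t x y z w →
       a :* x :^ 4 :+ b :* y :^ 4 :+ con 4 :* a :* z :^ 4 :+ con 4 :* b :* w :^ 4 :+ (a :* (t :* z) :^ 4 :+ b :* (t :* w) :^ 4)
       := a :* x :^ 4 :+ b :* y :^ 4 :+ (t :^ 4 :+ con 4) :* (a :* z :^ 4 :+ b :* w :^ 4))
    refl a b t x y z w
    where open +-*-Solver using (_:+_; _:*_; _:^_; _:=_; con)

  -- Opaque, so that the witness produced by the parity argument is never unfolded.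
  opaque
    t : ℕ
    t = proj₁ (∃-fourthRoot[-4] q-prime q%4≡1)

    t⁴+4≈0 : t ^ 4 + 4 ≈ 0
    t⁴+4≈0 = ∣⇒≈0 (proj₂ (∃-fourthRoot[-4] q-prime q%4≡1))

  t≉0 : ¬ t ≈ 0
  t≉0 t≈0 = prime≡1[mod4]⇒∤4 q-prime q%4≡1 (∣m+n∣m⇒∣n (≈0⇒∣ t⁴+4≈0) (∣m⇒∣m*n (t ^ 3) (≈0⇒∣ t≈0)))

  scale : Fin 4 → ℕ
  scale zero                   = c₁
  scale (suc zero)             = c₂
  scale (suc (suc zero))       = t * c₃
  scale (suc (suc (suc zero))) = t * c₄

  scale≉0 : ∀ j → ¬ scale j ≈ 0
  scale≉0 zero                   c₁≈0 = q∤abc (∣m⇒∣m*n c₄ (∣m⇒∣m*n c₃ (∣m⇒∣m*n c₂ (∣n⇒∣m*n (a * b) (≈0⇒∣ c₁≈0)))))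
  scale≉0 (suc zero)             c₂≈0 = q∤abc (∣m⇒∣m*n c₄ (∣m⇒∣m*n c₃ (∣n⇒∣m*n (a * b * c₁) (≈0⇒∣ c₂≈0))))
  scale≉0 (suc (suc zero))            = *-≉0 q-prime t≉0 λ c₃≈0 → q∤abc (∣m⇒∣m*n c₄ (∣n⇒∣m*n (a * b * c₁ * c₂) (≈0⇒∣ c₃≈0)))
  scale≉0 (suc (suc (suc zero)))      = *-≉0 q-prime t≉0 λ c₄≈0 → q∤abc (∣n⇒∣m*n (a * b * c₁ * c₂ * c₃) (≈0⇒∣ c₄≈0))

  β : Vec (Fin q) 4 ↔ Vec (Fin q) 4
  β = scalePermute σ scale (λ j → proj₁ (∃-inverse q-prime (scale≉0 j))) (λ j → proj₂ (∃-inverse q-prime (scale≉0 j)))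

  F≡0 : Point q → Set
  F≡0 x = F a b c₁ c₂ c₃ c₄ σ (λ i → toℕ (lookup x i)) % q ≡ 0

  F≡0? : ∀ x → Dec (F≡0 x)
  F≡0? x = F a b c₁ c₂ c₃ c₄ σ (λ i → toℕ (lookup x i)) % q ≟ 0

  indicator-F≡0≡collision∘β : ∀ v → indicator (F≡0? v) ≡ collision (Inverse.to β v)
  indicator-F≡0≡collision∘β v = indicator-cong _ _ (begin
    F≡0 v                                        ≈⟨ %≡0⇔≈0 ⟩
    Fv ≈ 0                                       ≈⟨ x+z≈y⇒[x≈0⇔y≈z] Fv+Q[tP₂,tP₃]≈Q[P₀,P₁] ⟩
    Q (P i₀) (P i₁) ≈ Q (t * P i₂) (t * P i₃)    ≈⟨ ≈-cong-⇔ (Q-cong (w≈P i₀) (w≈P i₁)) (Q-cong w₂≈tP₂ w₃≈tP₃) ⟨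
    Q (w i₀) (w i₁) ≈ Q (w i₂) (w i₃)            ≈⟨ mod≡mod⇔≈ ⟨
    Q (w i₀) (w i₁) mod q ≡ Q (w i₂) (w i₃) mod q ∎)
    where
    open SetoidReasoning (⇔-setoid 0ℓ)
    i₀ i₁ i₂ i₃ : Fin 4
    i₀ = zero
    i₁ = suc zero
    i₂ = suc (suc zero)
    i₃ = suc (suc (suc zero))
    X : Fin 4 → ℕ
    X i = toℕ (lookup v i)
    Fv = F a b c₁ c₂ c₃ c₄ σ X
    c P w : Fin 4 → ℕ
    c zero                   = c₁
    c (suc zero)             = c₂
    c (suc (suc zero))       = c₃
    c (suc (suc (suc zero))) = c₄
    P j = c j * X (σ ⟨$⟩ʳ j)
    w j = toℕ (scale j · lookup v (σ ⟨$⟩ʳ j))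
    w≈P : ∀ j → w j ≈ scale j * X (σ ⟨$⟩ʳ j)
    w≈P j = toℕ-· (scale j) (lookup v (σ ⟨$⟩ʳ j))
    w₂≈tP₂ : w i₂ ≈ t * P i₂
    w₂≈tP₂ = ≈-trans (w≈P i₂) (≡⇒≈ (*-assoc t c₃ (X (σ ⟨$⟩ʳ i₂))))
    w₃≈tP₃ : w i₃ ≈ t * P i₃
    w₃≈tP₃ = ≈-trans (w≈P i₃) (≡⇒≈ (*-assoc t c₄ (X (σ ⟨$⟩ʳ i₃))))
    Fv+Q[tP₂,tP₃]≈Q[P₀,P₁] : Fv + Q (t * P i₂) (t * P i₃) ≈ Q (P i₀) (P i₁)
    Fv+Q[tP₂,tP₃]≈Q[P₀,P₁] =
      ≈-trans (≡⇒≈ (F+Q[tz,tw]≡Q[x,y]+[t⁴+4]Q[z,w] t (P i₀) (P i₁) (P i₂) (P i₃)))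
              (≈-trans (+-cong (≈-refl {Q (P i₀) (P i₁)}) (*-cong t⁴+4≈0 (≈-refl {Q (P i₂) (P i₃)})))
                       (≡⇒≈ (+-identityʳ (Q (P i₀) (P i₁)))))

  -- The last step is definitional: ∑ᵛ 4 collision unfolds to a double sum over pairs.
  rF0≡collisions : rF0 a b c₁ c₂ c₃ c₄ σ q ≡ collisions (Q-mod ∘ decode 2)
  rF0≡collisions = begin
    rF0 a b c₁ c₂ c₃ c₄ σ q                          ≡⟨ length∘filter≡sum∘map-indicator F≡0? (allPoints q) ⟩
    sumᴸ (List.map (indicator ∘ F≡0?) (allPoints q))  ≡⟨ sum∘map-allVecs 4 (indicator ∘ F≡0?) ⟩
    ∑ᵛ 4 (indicator ∘ F≡0?)                          ≡⟨ ∑ᵛ-cong 4 indicator-F≡0≡collision∘β ⟩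
    ∑ᵛ 4 (collision ∘ Inverse.to β)                  ≡⟨ ∑ᵛ-↔ 4 β collision ⟩
    ∑ᵛ 4 collision                                   ≡⟨ ∑ᵛ-collisions 2 Q-mod ⟩
    collisions (Q-mod ∘ decode 2)                    ∎
    where open ≡-Reasoning

lemma6p3 : (a b c₁ c₂ c₃ c₄ : ℕ) → a > 0 → b > 0 → c₁ > 0 → c₂ > 0 → c₃ > 0 → c₄ > 0 →
    (σ : Permutation′ 4) → (q : ℕ) → (qp : Prime q) → q % 4 ≡ 1 →
    ¬ (q ∣ a * b * c₁ * c₂ * c₃ * c₄) →
    q ^ 3 ≤ rF0 a b c₁ c₂ c₃ c₄ σ q {{prime⇒nonZero qp}}
lemma6p3 a b c₁ c₂ c₃ c₄ _ _ _ _ _ _ σ q qp q%4≡1 q∤abc = *-cancelˡ-≤ q {{prime⇒nonZero qp}} (begin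
  q * q ^ 3                          ≡⟨ ^-distribˡ-+-* q 2 2 ⟩
  q ^ 2 * q ^ 2                      ≤⟨ collisions-lowerBound (Q-mod ∘ decode 2) ⟩
  q * collisions (Q-mod ∘ decode 2)  ≡⟨ cong (q *_) rF0≡collisions ⟨
  q * rF0 a b c₁ c₂ c₃ c₄ σ q {{prime⇒nonZero qp}} ∎)
  where
  open PointCount a b c₁ c₂ c₃ c₄ σ qp q%4≡1 q∤abc
  open ≤-Reasoning
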